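{- Let $E_0,E_1\in\mathcal P^e$. If $top(E_0)\,\Re\,top(E_1)$ then $lab(E_0)\,\Re\,lab(E_1)$.
   Context: $\mathcal P$ is the set of choiceless $\pi$-calculus processes $P::=0\mid x(y).P\mid \bar xy.P\mid P\,|\,P\mid(\nu x)P\mid\, !P$ over an infinite set of names. Labels are pairs $\langle s,n\rangle\in\{0,1\}^*\times\mathbb N$; $s_0\sqsubseteq s_1$ means the string $s_0$ is a prefix of $s_1$; for label sets, $L_0\,\Re\,L_1$ iff for all $\langle s_0,n_0\rangle\in L_0$, $\langle s_1,n_1\rangle\in L_1$: $s_0\not\sqsubseteq s_1$ and $s_1\not\sqsubseteq s_0$. Ground labeled terms $\mathcal P^e_{gr}$: $E::=0\mid \mu_{\langle s,n\rangle}.E\mid(\nu x)E\mid E\,|\,E\mid\, !_{\langle s,n\rangle}P$, with $\mu$ a prefix $x(y)$ or $\bar xy$ and $P\in\mathcal P$ unlabeled. Labeling function: $L_{\langle s,n\rangle}(0)=0$; $L_{\langle s,n\rangle}(\mu.P)=\mu_{\langle s,n\rangle}.L_{\langle s,n+1\rangle}(P)$; $L_{\langle s,n\rangle}(P_0|P_1)=L_{\langle s0,n\rangle}(P_0)\,|\,L_{\langle s1,n\rangle}(P_1)$; $L_{\langle s,n\rangle}((\nu x)P)=(\nu x)L_{\langle s,n\rangle}(P)$; $L_{\langle s,n\rangle}(!P)=\,!_{\langle s,n\rangle}P$. $top(0)=lab(0)=\emptyset$; $top(\mu_v.E)=\{v\}$, $lab(\mu_v.E)=\{v\}\cup lab(E)$;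 $top,lab$ of $(\nu x)E$ equal those of $E$; $top(E_0|E_1)=top(E_0)\cup top(E_1)$, $lab(E_0|E_1)=lab(E_0)\cup lab(E_1)$; $top(!_vP)=lab(!_vP)=\{v\}$. $wf$ is the least predicate with: $wf(0)$; $wf(L_{\langle s,n\rangle}(\mu.P))$ for every $\mu.P\in\mathcal P$ and label; $wf(E_0|E_1)$ if $wf(E_0)$, $wf(E_1)$, $top(E_0)\,\Re\,top(E_1)$; $wf((\nu x)E)$ if $wf(E)$; $wf(!_{\langle s,n\rangle}P)$ for every $P\in\mathcal P$ and label. $\mathcal P^e=\{E\in\mathcal P^e_{gr}:wf(E)\}$. -}

module Defs where

open import Data.Bool using (Bool; true; false)
open import Data.Nat using (ℕ; suc)
open import Data.List using (List; []; _∷_; _++_; [_])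
open import Data.List.Membership.Propositional using (_∈_)
open import Data.List.Relation.Binary.Prefix.Heterogeneous using (Prefix)
open import Data.Product using (_×_; _,_)
open import Relation.Binary.PropositionalEquality using (_≡_)
open import Relation.Nullary using (¬_)

Name : Set
Name = ℕ

data Prefixμ : Set where
  inp : Name → Name → Prefixμ
  out : Name → Name → Prefixμ

data Proc : Set where
  𝟎    : Proc
  _∙_  : Prefixμ → Proc → Proc
  _∣_  : Proc → Proc → Proc
  ν    : Name → Proc → Proc
  !_   : Proc → Proc

-- Binary strings {0,1}*: false = 0, true = 1
BStr : Set
BStr = List Bool

Label : Set
Label = BStr × ℕ

_⊑_ : BStr → BStr → Set
s₀ ⊑ s₁ = Prefix _≡_ s₀ s₁

data LTerm : Set where
  𝟎    : LTerm
  pre  : Prefixμ → Label → LTerm → LTerm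
  ν    : Name → LTerm → LTerm
  _∣_  : LTerm → LTerm → LTerm
  bang : Label → Proc → LTerm

lab-fn : BStr → ℕ → Proc → LTerm
lab-fn s n 𝟎 = 𝟎
lab-fn s n (μ ∙ P) = pre μ (s , n) (lab-fn s (suc n) P)
lab-fn s n (P₀ ∣ P₁) = lab-fn (s ++ [ false ]) n P₀ ∣ lab-fn (s ++ [ true ]) n P₁
lab-fn s n (ν x P) = ν x (lab-fn s n P)
lab-fn s n (! P) = bang (s , n) P

-- Finite label sets, represented as lists (membership = set membership)
LabelSet : Set
LabelSet = List Label

top : LTerm → LabelSet
top 𝟎 = []
top (pre μ v E) = [ v ]
top (ν x E) = top E
top (E₀ ∣ E₁) = top E₀ ++ top E₁
top (bang v P) = [ v ]

lab : LTerm → LabelSet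
lab 𝟎 = []
lab (pre μ v E) = v ∷ lab E
lab (ν x E) = lab E
lab (E₀ ∣ E₁) = lab E₀ ++ lab E₁
lab (bang v P) = [ v ]

_ℜ_ : LabelSet → LabelSet → Set
L₀ ℜ L₁ = ∀ {s₀ n₀ s₁ n₁} → (s₀ , n₀) ∈ L₀ → (s₁ , n₁) ∈ L₁ →
          ¬ (s₀ ⊑ s₁) × ¬ (s₁ ⊑ s₀)

data wf : LTerm → Set where
  wf-0    : wf 𝟎
  wf-pre  : ∀ μ P s n → wf (lab-fn s n (μ ∙ P))
  wf-par  : ∀ {E₀ E₁} → wf E₀ → wf E₁ → top E₀ ℜ top E₁ → wf (E₀ ∣ E₁)
  wf-ν    : ∀ {x E} → wf E → wf (ν x E)
  wf-bang : ∀ P v → wf (bang v P)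

-- Every label of a well-formed term extends (as a string) one of its top
-- labels: a prefix μ_⟨s,n⟩.E produced by L_⟨s,n⟩ only ever appends bits to s
-- further down. Two strings extending incomparable strings are themselves
-- incomparable, since two prefixes of one string are comparable.
module Submission where

open import Defs
open import Data.Empty using (⊥)
open import Data.Nat using (suc)
open import Data.List using (List; _++_)
open import Data.List.Membership.Propositional using (_∈_)
open import Data.List.Membership.Propositional.Properties using (∈-++⁺ˡ; ∈-++⁺ʳ; ∈-++⁻)
open import Data.List.Relation.Unary.Any using (here; there)
open import Data.List.Relation.Binary.Prefix.Heterogeneous as Prefix using (Prefix; []; _∷_; fromView)
import Data.List.Relation.Binary.Prefix.Heterogeneous.Properties as Prefixₚ
import Data.List.Relation.Binary.Pointwise as Pointwise
open import Data.Product using (_×_; _,_; ∃₂)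
open import Data.Sum using (_⊎_; inj₁; inj₂)
open import Relation.Binary.PropositionalEquality as ≡ using (_≡_; refl)
open import Relation.Nullary using (¬_)

⊑-refl : ∀ {s} → s ⊑ s
⊑-refl = Prefixₚ.fromPointwise (Pointwise.refl refl)

⊑-trans : ∀ {s t u} → s ⊑ t → t ⊑ u → s ⊑ u
⊑-trans = Prefixₚ.trans ≡.trans

⊑-++ʳ : ∀ s t → s ⊑ (s ++ t)
⊑-++ʳ s t = fromView (Pointwise.refl refl Prefix.++ t)

prefixes-comparable : ∀ {a} {A : Set a} {as bs cs : List A} →
                      Prefix _≡_ as cs → Prefix _≡_ bs cs →
                      Prefix _≡_ as bs ⊎ Prefix _≡_ bs as
prefixes-comparable [] _ = inj₁ []
prefixes-comparable (_ ∷ _) [] = inj₂ []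
prefixes-comparable (refl ∷ p) (refl ∷ q) with prefixes-comparable p q
... | inj₁ r = inj₁ (refl ∷ r)
... | inj₂ r = inj₂ (refl ∷ r)

Incomparable : BStr → BStr → Set
Incomparable s t = ¬ (s ⊑ t) × ¬ (t ⊑ s)

incomparable-extensions : ∀ {u₀ u₁ t₀ t₁} → Incomparable u₀ u₁ →
                          u₀ ⊑ t₀ → u₁ ⊑ t₁ → Incomparable t₀ t₁
incomparable-extensions {u₀} {u₁} (u₀⋢u₁ , u₁⋢u₀) u₀⊑t₀ u₁⊑t₁ =
    (λ t₀⊑t₁ → common-extension (⊑-trans u₀⊑t₀ t₀⊑t₁) u₁⊑t₁)
  , (λ t₁⊑t₀ → common-extension u₀⊑t₀ (⊑-trans u₁⊑t₁ t₁⊑t₀))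
  where
    common-extension : ∀ {t} → u₀ ⊑ t → u₁ ⊑ t → ⊥
    common-extension p q with prefixes-comparable p q
    ... | inj₁ r = u₀⋢u₁ r
    ... | inj₂ r = u₁⋢u₀ r

Above : LabelSet → LabelSet → Set
Above L M = ∀ {t k} → (t , k) ∈ M → ∃₂ λ u j → (u , j) ∈ L × u ⊑ t

ℜ-above : ∀ {L₀ L₁ M₀ M₁} → L₀ ℜ L₁ → Above L₀ M₀ → Above L₁ M₁ → M₀ ℜ M₁
ℜ-above L₀ℜL₁ M₀≥L₀ M₁≥L₁ i₀ i₁ with M₀≥L₀ i₀ | M₁≥L₁ i₁
... | _ , _ , m₀ , u₀⊑t₀ | _ , _ , m₁ , u₁⊑t₁ =
  incomparable-extensions (L₀ℜL₁ m₀ m₁) u₀⊑t₀ u₁⊑t₁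

lab-fn-extends : ∀ s n P {t k} → (t , k) ∈ lab (lab-fn s n P) → s ⊑ t
lab-fn-extends s n (μ ∙ P) (here refl) = ⊑-refl
lab-fn-extends s n (μ ∙ P) (there i) = lab-fn-extends s (suc n) P i
lab-fn-extends s n (P₀ ∣ P₁) i with ∈-++⁻ (lab (lab-fn (s ++ _) n P₀)) i
... | inj₁ i₀ = ⊑-trans (⊑-++ʳ s _) (lab-fn-extends _ n P₀ i₀)
... | inj₂ i₁ = ⊑-trans (⊑-++ʳ s _) (lab-fn-extends _ n P₁ i₁)
lab-fn-extends s n (ν x P) i = lab-fn-extends s n P i
lab-fn-extends s n (! P) (here refl) = ⊑-refl

wf⇒lab-above-top : ∀ {E} → wf E → Above (top E) (lab E)
wf⇒lab-above-top (wf-pre μ P s n) (here refl) = s , n , here refl , ⊑-refl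
wf⇒lab-above-top (wf-pre μ P s n) (there i) =
  s , n , here refl , lab-fn-extends s (suc n) P i
wf⇒lab-above-top (wf-par {E₀} {E₁} w₀ w₁ _) i with ∈-++⁻ (lab E₀) i
... | inj₁ i₀ with wf⇒lab-above-top w₀ i₀
...   | u , j , m , u⊑t = u , j , ∈-++⁺ˡ m , u⊑t
wf⇒lab-above-top (wf-par {E₀} {E₁} w₀ w₁ _) i | inj₂ i₁ with wf⇒lab-above-top w₁ i₁
...   | u , j , m , u⊑t = u , j , ∈-++⁺ʳ (top E₀) m , u⊑t
wf⇒lab-above-top (wf-ν w) i = wf⇒lab-above-top w i
wf⇒lab-above-top (wf-bang P (s , n)) (here refl) = s , n , here refl , ⊑-refl

lemmaA6 : (E₀ E₁ : LTerm) → wf E₀ → wf E₁ →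
    top E₀ ℜ top E₁ → lab E₀ ℜ lab E₁
lemmaA6 E₀ E₁ w₀ w₁ tops =
  ℜ-above tops (wf⇒lab-above-top w₀) (wf⇒lab-above-top w₁)
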